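{- Let $M$ be a map with a single zigzag and edge set $E$. For $x,y\in E$: $y\in b_P(x)$ if and only if $x\in b_P(y)$.
   Context: A map $M$ is a graph $G_M$ with edge set $E=\{1,\dots,n\}$ cellularly embedded in a closed surface; it has a single zigzag (a closed walk alternately taking the leftmost and rightmost continuation at each vertex), which traverses each edge exactly twice, and the cyclic sequence of traversed edges is the Gauss code $\overline{P}$. An edge is black if the zigzag traverses it twice in the same direction, white otherwise. Identify subsets of $E$ with vectors in $\mathbb{Z}_2^E$ and $x$ with $\{x\}$. Linear maps on singletons: $i_{\overline{P}}(x)$ = set of edges occurring exactly once in $\overline{P}$ strictly between the two occurrences of $x$; $\kappa_P(x)=\{x\}$ if $x$ black, $\emptyset$ if white; $c_P=\kappa_P+i_{\overline{P}}$, $c_{P^\sim}=c_P+\mathrm{id}$, $b_P=c_{P^\sim}\circ c_P$. -}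

module Defs where

open import Data.Nat using (ℕ; zero; suc; _≡ᵇ_)
open import Data.Bool using (Bool; true; false; _∧_; _xor_; not; if_then_else_)
open import Data.Fin using (Fin; toℕ)
open import Data.List using (List; []; _∷_; allFin; foldr)
open import Data.Product using (_×_; _,_; proj₁)
open import Relation.Binary.PropositionalEquality using (_≡_)

-- Edge set E = Fin n.  Subsets of E = vectors in Z₂^E = functions Fin n → Bool.
Subset : ℕ → Set
Subset n = Fin n → Bool

_==_ : ∀ {n} → Fin n → Fin n → Bool
x == y = toℕ x ≡ᵇ toℕ y

⟦_⟧ : ∀ {n} → Fin n → Subset n
⟦ x ⟧ y = x == y

_⊕_ : ∀ {n} → Subset n → Subset n → Subset n
(S ⊕ T) y = S y xor T y

-- Linear extension of a map given on singletons:
-- lin f S = Σ_{x ∈ S} f x  (over Z₂)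
lin : ∀ {n} → (Fin n → Subset n) → Subset n → Subset n
lin {n} f S y = foldr (λ x acc → (S x ∧ f x y) xor acc) false (allFin n)

-- A zigzag, written linearly (starting at an arbitrary point of the cyclic
-- walk): the sequence of traversed edges, each tagged with the direction
-- (relative to a fixed reference orientation of that edge) in which it is
-- traversed.
Zigzag : ℕ → Set
Zigzag n = List (Fin n × Bool)

count : ∀ {n} → Fin n → List (Fin n) → ℕ
count x [] = zero
count x (y ∷ ys) = if x == y then suc (count x ys) else count x ys

gauss : ∀ {n} → Zigzag n → List (Fin n)
gauss [] = []
gauss ((e , _) ∷ w) = e ∷ gauss w

TraversesEachTwice : ∀ {n} → Zigzag n → Set
TraversesEachTwice {n} Z = (x : Fin n) → count x (gauss Z) ≡ 2

after : ∀ {n} → Fin n → List (Fin n) → List (Fin n)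
after x [] = []
after x (y ∷ ys) = if x == y then ys else after x ys

before : ∀ {n} → Fin n → List (Fin n) → List (Fin n)
before x [] = []
before x (y ∷ ys) = if x == y then [] else y ∷ before x ys

between : ∀ {n} → Fin n → List (Fin n) → List (Fin n)
between x P = before x (after x P)

dirs : ∀ {n} → Fin n → Zigzag n → List Bool
dirs x [] = []
dirs x ((e , d) ∷ w) = if x == e then d ∷ dirs x w else dirs x w

black : ∀ {n} → Zigzag n → Fin n → Bool
black Z x with dirs x Z
... | d₁ ∷ d₂ ∷ _ = not (d₁ xor d₂)
... | _ = false

iP : ∀ {n} → Zigzag n → Fin n → Subset n
iP Z x y = count y (between x (gauss Z)) ≡ᵇ 1

κP : ∀ {n} → Zigzag n → Fin n → Subset n
κP Z x y = black Z x ∧ (x == y)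

cP : ∀ {n} → Zigzag n → Fin n → Subset n
cP Z x = κP Z x ⊕ iP Z x

cP~ : ∀ {n} → Zigzag n → Fin n → Subset n
cP~ Z x = cP Z x ⊕ ⟦ x ⟧

bP : ∀ {n} → Zigzag n → Fin n → Subset n
bP Z x = lin (cP~ Z) (cP Z x)

-- Over Z₂ we have b_P = c_{P~} ∘ c_P = c_P² + c_P, so b_P is symmetric as soon as c_P is.
-- The diagonal part κ_P is symmetric, and so is i_P̄ by an interlacing argument: for
-- x ≠ y, the pairs (an occurrence of x, a later occurrence of y) together with the pairs
-- (an occurrence of y, a later occurrence of x) number count x · count y = 4, while for a
-- doubly occurring x the first kind of pair has the parity of the number of y's between
-- the two x's.
module Submission where

open import Defs
open import Algebra.Bundles using (CommutativeRing)
open import Data.Bool using (Bool; true; false; not; _∧_; _xor_)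
open import Data.Bool.Properties
  using (xor-∧-commutativeRing; xor-assoc; xor-comm; xor-same; xor-identityʳ;
         not-distribˡ-xor; ∧-identityʳ; ∧-zeroʳ; ∧-comm; ∧-distribˡ-xor; ∧-distribʳ-xor)
open import Data.Empty using (⊥-elim)
open import Data.Fin using (Fin; zero; suc; toℕ)
open import Data.Fin.Properties using (toℕ-injective) renaming (_≟_ to _≟ᶠ_)
open import Data.List using (List; []; _∷_; foldr; tabulate)
open import Data.Nat using (ℕ; _+_; _≤_; _≡ᵇ_; s≤s; z≤n)
open import Data.Nat.Properties
  using (≡ᵇ⇒≡; ≡⇒≡ᵇ; ≤-trans; ≤-reflexive; m≤m+n; m≤n+m; suc-injective)
open import Function using (id; _∘_)
open import Function.Bundles using (_⇔_; mk⇔)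
open import Relation.Binary.PropositionalEquality
  using (_≡_; _≢_; refl; sym; trans; cong; cong₂; module ≡-Reasoning)
open import Relation.Nullary using (yes; no)
open import Relation.Nullary.Reflects using (Reflects; ofʸ; ofⁿ; fromEquivalence; det)

open import Algebra.Properties.Semiring.Sum (CommutativeRing.semiring xor-∧-commutativeRing)
  using (sum-syntax; sum-cong-≗; sum-replicate-zero; ∑-distrib-+)
open import Algebra.Properties.Group (CommutativeRing.+-group xor-∧-commutativeRing)
  using (x∙y⁻¹≈ε⇒x≈y)

open ≡-Reasoning

==-reflects : ∀ {n} (x y : Fin n) → Reflects (x ≡ y) (x == y)
==-reflects x y = fromEquivalence (toℕ-injective ∘ ≡ᵇ⇒≡ _ _) (≡⇒≡ᵇ _ _ ∘ cong toℕ)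

≢⇒==-false : ∀ {n} {x y : Fin n} → x ≢ y → x == y ≡ false
≢⇒==-false {x = x} {y} x≢y = det (==-reflects x y) (ofⁿ x≢y)

infix 6 _⊕id
infixr 5 _∘ₗ_

_⊕id : ∀ {n} → (Fin n → Subset n) → Fin n → Subset n
(C ⊕id) x = C x ⊕ ⟦ x ⟧

_∘ₗ_ : ∀ {n} → (Fin n → Subset n) → (Fin n → Subset n) → Fin n → Subset n
(D ∘ₗ C) x = lin D (C x)

IsSymmetric : ∀ {n} → (Fin n → Subset n) → Set
IsSymmetric C = ∀ x y → C x y ≡ C y x

lin-∑ : ∀ {n} (f : Fin n → Subset n) (S : Subset n) y → lin f S y ≡ ∑[ z < n ] (S z ∧ f z y)
lin-∑ f S y = foldr-tabulate (λ z → S z ∧ f z y) id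
  where
  foldr-tabulate : ∀ {m k} (h : Fin m → Bool) (g : Fin k → Fin m) →
    foldr (λ z acc → h z xor acc) false (tabulate g) ≡ ∑[ i < k ] h (g i)
  foldr-tabulate {k = ℕ.zero} h g = refl
  foldr-tabulate {k = ℕ.suc k} h g = cong (h (g zero) xor_) (foldr-tabulate h (g ∘ suc))

∑-δ : ∀ {n} (f : Fin n → Bool) y → ∑[ z < n ] (f z ∧ (z == y)) ≡ f y
∑-δ {ℕ.suc n} f zero = begin
  (f zero ∧ true) xor ∑[ z < n ] (f (suc z) ∧ false)  ≡⟨ cong₂ _xor_ (∧-identityʳ (f zero)) rest-vanishes ⟩
  f zero xor false                                    ≡⟨ xor-identityʳ (f zero) ⟩
  f zero                                              ∎
  where
  rest-vanishes : ∑[ z < n ] (f (suc z) ∧ false) ≡ false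
  rest-vanishes = trans (sum-cong-≗ (∧-zeroʳ ∘ f ∘ suc)) (sum-replicate-zero n)
∑-δ {ℕ.suc n} f (suc y) =
  trans (cong (_xor ∑[ z < n ] (f (suc z) ∧ (z == y))) (∧-zeroʳ (f zero))) (∑-δ (f ∘ suc) y)

⊕id∘ₗ-apply : ∀ {n} (C : Fin n → Subset n) x y →
  (C ⊕id ∘ₗ C) x y ≡ ∑[ z < n ] (C x z ∧ C z y) xor C x y
⊕id∘ₗ-apply {n} C x y = begin
  lin (C ⊕id) (C x) y
    ≡⟨ lin-∑ (C ⊕id) (C x) y ⟩
  ∑[ z < n ] (C x z ∧ (C z y xor (z == y)))
    ≡⟨ sum-cong-≗ (λ z → ∧-distribˡ-xor (C x z) (C z y) (z == y)) ⟩
  ∑[ z < n ] ((C x z ∧ C z y) xor (C x z ∧ (z == y)))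
    ≡⟨ ∑-distrib-+ (λ z → C x z ∧ C z y) (λ z → C x z ∧ (z == y)) ⟩
  ∑[ z < n ] (C x z ∧ C z y) xor ∑[ z < n ] (C x z ∧ (z == y))
    ≡⟨ cong (∑[ z < n ] (C x z ∧ C z y) xor_) (∑-δ (C x) y) ⟩
  ∑[ z < n ] (C x z ∧ C z y) xor C x y
    ∎

⊕id∘ₗ-symmetric : ∀ {n} {C : Fin n → Subset n} → IsSymmetric C → IsSymmetric (C ⊕id ∘ₗ C)
⊕id∘ₗ-symmetric {n} {C} C-sym x y = begin
  (C ⊕id ∘ₗ C) x y                      ≡⟨ ⊕id∘ₗ-apply C x y ⟩
  ∑[ z < n ] (C x z ∧ C z y) xor C x y  ≡⟨ cong₂ _xor_ (sum-cong-≗ swap) (C-sym x y) ⟩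
  ∑[ z < n ] (C y z ∧ C z x) xor C y x  ≡⟨ ⊕id∘ₗ-apply C y x ⟨
  (C ⊕id ∘ₗ C) y x                      ∎
  where
  swap : ∀ z → C x z ∧ C z y ≡ C y z ∧ C z x
  swap z = trans (cong₂ _∧_ (C-sym x z) (C-sym z y)) (∧-comm (C z x) (C y z))

odd : ℕ → Bool
odd ℕ.zero = false
odd (ℕ.suc m) = not (odd m)

odd-+ : ∀ m n → odd (m + n) ≡ odd m xor odd n
odd-+ ℕ.zero n = refl
odd-+ (ℕ.suc m) n = trans (cong not (odd-+ m n)) (not-distribˡ-xor (odd m) (odd n))

≡ᵇ1≡odd : ∀ {m} → m ≤ 2 → (m ≡ᵇ 1) ≡ odd m
≡ᵇ1≡odd z≤n = refl
≡ᵇ1≡odd (s≤s z≤n) = refl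
≡ᵇ1≡odd (s≤s (s≤s z≤n)) = refl

crossingParity : ∀ {n} → Fin n → Fin n → List (Fin n) → Bool
crossingParity x y [] = false
crossingParity x y (z ∷ zs) = ((x == z) ∧ odd (count y zs)) xor crossingParity x y zs

crossingParity-swap : ∀ {n} {x y : Fin n} → x ≢ y → ∀ P →
  crossingParity x y P xor crossingParity y x P ≡ odd (count x P) ∧ odd (count y P)
crossingParity-swap x≢y [] = refl
crossingParity-swap {x = x} {y} x≢y (z ∷ zs)
  with x == z | ==-reflects x z | y == z | ==-reflects y z | crossingParity-swap x≢y zs
... | true  | ofʸ refl | true  | ofʸ refl | _  = ⊥-elim (x≢y refl)
... | false | _       | false | _       | ih = ih
... | true  | ofʸ refl | false | _       | ih = begin
  (Y xor Gxy) xor Gyx  ≡⟨ xor-assoc Y Gxy Gyx ⟩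
  Y xor (Gxy xor Gyx)  ≡⟨ cong (Y xor_) ih ⟩
  Y xor (X ∧ Y)        ≡⟨ ∧-distribʳ-xor Y true X ⟨
  not X ∧ Y            ∎
  where
  X = odd (count x zs)
  Y = odd (count y zs)
  Gxy = crossingParity x y zs
  Gyx = crossingParity y x zs
... | false | _       | true  | ofʸ refl | ih = begin
  Gxy xor (X xor Gyx)  ≡⟨ xor-assoc Gxy X Gyx ⟨
  (Gxy xor X) xor Gyx  ≡⟨ cong (_xor Gyx) (xor-comm Gxy X) ⟩
  (X xor Gxy) xor Gyx  ≡⟨ xor-assoc X Gxy Gyx ⟩
  X xor (Gxy xor Gyx)  ≡⟨ cong (X xor_) ih ⟩
  X xor (X ∧ Y)        ≡⟨ cong (_xor (X ∧ Y)) (∧-identityʳ X) ⟨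
  (X ∧ true) xor (X ∧ Y) ≡⟨ ∧-distribˡ-xor X true Y ⟨
  X ∧ not Y            ∎
  where
  X = odd (count x zs)
  Y = odd (count y zs)
  Gxy = crossingParity x y zs
  Gyx = crossingParity y x zs

crossingParity-absent : ∀ {n} {x y : Fin n} P → count x P ≡ 0 → crossingParity x y P ≡ false
crossingParity-absent [] _ = refl
crossingParity-absent {x = x} (z ∷ zs) h with x == z
crossingParity-absent (z ∷ zs) () | true
crossingParity-absent (z ∷ zs) h  | false = crossingParity-absent zs h

crossingParity-once : ∀ {n} {x y : Fin n} P → count x P ≡ 1 →
  crossingParity x y P ≡ odd (count y (after x P))
crossingParity-once [] ()
crossingParity-once {x = x} {y} (z ∷ zs) h with x == z
... | true  = trans (cong (odd (count y zs) xor_) (crossingParity-absent zs (suc-injective h)))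
                    (xor-identityʳ (odd (count y zs)))
... | false = crossingParity-once zs h

count-before-after : ∀ {n} {x y : Fin n} → x ≢ y → ∀ P →
  count y P ≡ count y (before x P) + count y (after x P)
count-before-after x≢y [] = refl
count-before-after {x = x} {y} x≢y (z ∷ zs) with x == z | ==-reflects x z
... | true  | ofʸ refl rewrite ≢⇒==-false (x≢y ∘ sym) = refl
... | false | _ with y == z
...   | true  = cong ℕ.suc (count-before-after x≢y zs)
...   | false = count-before-after x≢y zs

crossingParity-twice : ∀ {n} {x y : Fin n} → x ≢ y → ∀ P → count x P ≡ 2 →
  crossingParity x y P ≡ odd (count y (between x P))
crossingParity-twice x≢y [] ()
crossingParity-twice {x = x} {y} x≢y (z ∷ zs) h with x == z
... | false = crossingParity-twice x≢y zs h
... | true  = begin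
  odd (count y zs) xor crossingParity x y zs
    ≡⟨ cong₂ _xor_ (cong odd (count-before-after x≢y zs)) (crossingParity-once zs (suc-injective h)) ⟩
  odd (B + A) xor odd A        ≡⟨ cong (_xor odd A) (odd-+ B A) ⟩
  (odd B xor odd A) xor odd A  ≡⟨ xor-assoc (odd B) (odd A) (odd A) ⟩
  odd B xor (odd A xor odd A)  ≡⟨ cong (odd B xor_) (xor-same (odd A)) ⟩
  odd B xor false              ≡⟨ xor-identityʳ (odd B) ⟩
  odd B                        ∎
  where
  B = count y (before x zs)
  A = count y (after x zs)

count-between-≤ : ∀ {n} {x y : Fin n} → x ≢ y → ∀ P → count y (between x P) ≤ count y P
count-between-≤ {x = x} {y} x≢y P = ≤-trans (before-≤ (after x P)) after-≤
  where
  before-≤ : ∀ Q → count y (before x Q) ≤ count y Q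
  before-≤ Q = ≤-trans (m≤m+n _ _) (≤-reflexive (sym (count-before-after x≢y Q)))
  after-≤ : count y (after x P) ≤ count y P
  after-≤ = ≤-trans (m≤n+m _ _) (≤-reflexive (sym (count-before-after x≢y P)))

between-parity-symmetric : ∀ {n} {x y : Fin n} → x ≢ y → ∀ P → count x P ≡ 2 → count y P ≡ 2 →
  odd (count y (between x P)) ≡ odd (count x (between y P))
between-parity-symmetric {x = x} {y} x≢y P x-twice y-twice = begin
  odd (count y (between x P)) ≡⟨ crossingParity-twice x≢y P x-twice ⟨
  crossingParity x y P        ≡⟨ x∙y⁻¹≈ε⇒x≈y _ _ crossings-cancel ⟩  -- negation in Z₂ is the identity
  crossingParity y x P        ≡⟨ crossingParity-twice (x≢y ∘ sym) P y-twice ⟩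
  odd (count x (between y P)) ∎
  where
  crossings-cancel : crossingParity x y P xor crossingParity y x P ≡ false
  crossings-cancel =
    trans (crossingParity-swap x≢y P) (cong (λ c → odd c ∧ odd (count y P)) x-twice)

iP-odd : ∀ {n} (Z : Zigzag n) → TraversesEachTwice Z → ∀ {x y} → x ≢ y →
  iP Z x y ≡ odd (count y (between x (gauss Z)))
iP-odd Z twice {y = y} x≢y =
  ≡ᵇ1≡odd (≤-trans (count-between-≤ x≢y (gauss Z)) (≤-reflexive (twice y)))

iP-symmetric : ∀ {n} (Z : Zigzag n) → TraversesEachTwice Z → IsSymmetric (iP Z)
iP-symmetric Z twice x y with x ≟ᶠ y
... | yes refl = refl
... | no x≢y   = begin
  iP Z x y                            ≡⟨ iP-odd Z twice x≢y ⟩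
  odd (count y (between x (gauss Z))) ≡⟨ between-parity-symmetric x≢y (gauss Z) (twice x) (twice y) ⟩
  odd (count x (between y (gauss Z))) ≡⟨ iP-odd Z twice (x≢y ∘ sym) ⟨
  iP Z y x                            ∎

κP-symmetric : ∀ {n} (Z : Zigzag n) → IsSymmetric (κP Z)
κP-symmetric Z x y with x ≟ᶠ y
... | yes refl = refl
... | no x≢y   = trans (off-diagonal x≢y) (sym (off-diagonal (x≢y ∘ sym)))
  where
  off-diagonal : ∀ {u v} → u ≢ v → κP Z u v ≡ false
  off-diagonal {u} u≢v = trans (cong (black Z u ∧_) (≢⇒==-false u≢v)) (∧-zeroʳ (black Z u))

cP-symmetric : ∀ {n} (Z : Zigzag n) → TraversesEachTwice Z → IsSymmetric (cP Z)
cP-symmetric Z twice x y = cong₂ _xor_ (κP-symmetric Z x y) (iP-symmetric Z twice x y)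

bP-symmetric : ∀ {n} (Z : Zigzag n) → TraversesEachTwice Z → IsSymmetric (bP Z)
bP-symmetric Z twice = ⊕id∘ₗ-symmetric (cP-symmetric Z twice)

proposition8 : (n : ℕ) (Z : Zigzag n) → TraversesEachTwice Z →
    (x y : Fin n) → (bP Z x y ≡ true) ⇔ (bP Z y x ≡ true)
proposition8 n Z twice x y = mk⇔ (trans (b-sym y x)) (trans (b-sym x y))
  where
  b-sym : IsSymmetric (bP Z)
  b-sym = bP-symmetric Z twice
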